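{- Let $L_1$ be the graph with vertex set $\{a,b,c,z\}$ and edge set $\{(a,b),(a,c),(b,c),(c,z)\}$. Let $\theta$ be any rectangle representation of $L_1$. Then $\theta(c)\not\subseteq \theta(a)\cup\theta(b)$.
   Context: A rectangle representation of a graph $G$ is a map $\theta$ assigning to each vertex $v$ an axis-parallel rectangle $\theta(v)=\Pi_1(v)\times\Pi_2(v)\subseteq\mathbb{R}^2$, where $\Pi_1(v),\Pi_2(v)$ are closed intervals of the real line, such that for distinct vertices $u,v$, $(u,v)$ is an edge of $G$ if and only if $\theta(u)\cap\theta(v)\neq\emptyset$. -}

module Defs where

open import Level using (Level; _⊔_)
open import Data.Product using (_×_; _,_; ∃)
open import Data.Sum using (_⊎_)
open import Relation.Binary.PropositionalEquality using (_≡_)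
open import Relation.Nullary using (¬_)
open import Relation.Binary.Bundles using (TotalOrder)
open import Function.Bundles using (_⇔_)

data V : Set where
  a b c z : V

data Edge : V → V → Set where
  ab : Edge a b
  ba : Edge b a
  ac : Edge a c
  ca : Edge c a
  bc : Edge b c
  cb : Edge c b
  cz : Edge c z
  zc : Edge z c

-- Geometry over a totally ordered "real line" (generalising ℝ).
module Geometry {ℓc ℓ₁ ℓ₂ : Level} (O : TotalOrder ℓc ℓ₁ ℓ₂) where
  open TotalOrder O renaming (Carrier to Line)

  record Interval : Set (ℓc ⊔ ℓ₂) where
    constructor [_,_]⟨_⟩
    field
      lo  : Line
      hi  : Line
      lo≤hi : lo ≤ hi

  _∈I_ : Line → Interval → Set ℓ₂
  x ∈I I = (Interval.lo I ≤ x) × (x ≤ Interval.hi I)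

  Point : Set ℓc
  Point = Line × Line

  Rectangle : Set (ℓc ⊔ ℓ₂)
  Rectangle = Interval × Interval

  _∈R_ : Point → Rectangle → Set ℓ₂
  (x , y) ∈R (I₁ , I₂) = (x ∈I I₁) × (y ∈I I₂)

  Meets : Rectangle → Rectangle → Set (ℓc ⊔ ℓ₂)
  Meets R S = ∃ λ p → (p ∈R R) × (p ∈R S)

  _⊆_∪_ : Rectangle → Rectangle → Rectangle → Set (ℓc ⊔ ℓ₂)
  R ⊆ S ∪ T = ∀ p → p ∈R R → (p ∈R S) ⊎ (p ∈R T)

  IsRectRep : (V → Rectangle) → Set (ℓc ⊔ ℓ₂)
  IsRectRep θ = ∀ u v → ¬ (u ≡ v) → Edge u v ⇔ Meets (θ u) (θ v)

{-# OPTIONS --safe #-}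
module Submission where

open import Defs
open import Level using (Level)
open import Relation.Nullary using (¬_)
open import Relation.Binary.Bundles using (TotalOrder)
open import Relation.Binary.PropositionalEquality using (_≡_)
open import Data.Product using (_,_)
open import Data.Sum using (_⊎_; inj₁; inj₂; [_,_])
open import Function.Base using (_∘_)
open import Function.Bundles using (Equivalence)

module _ {ℓc ℓ₁ ℓ₂ : Level} (O : TotalOrder ℓc ℓ₁ ℓ₂) where
  open Geometry O

  meets-⊆-∪ : ∀ {R S T W} → R ⊆ S ∪ T → Meets W R → Meets W S ⊎ Meets W T
  meets-⊆-∪ R⊆S∪T (p , p∈W , p∈R) with R⊆S∪T p p∈R
  ... | inj₁ p∈S = inj₁ (p , p∈W , p∈S)
  ... | inj₂ p∈T = inj₂ (p , p∈W , p∈T)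

  module _ (θ : V → Rectangle) (rep : IsRectRep θ) where

    edge⇒meets : ∀ {u v} → ¬ u ≡ v → Edge u v → Meets (θ u) (θ v)
    edge⇒meets u≢v = Equivalence.to (rep _ _ u≢v)

    ¬edge⇒¬meets : ∀ {u v} → ¬ u ≡ v → ¬ Edge u v → ¬ Meets (θ u) (θ v)
    ¬edge⇒¬meets u≢v ¬uv = ¬uv ∘ Equivalence.from (rep _ _ u≢v)

lemma1 : ∀ {ℓc ℓ₁ ℓ₂} (O : TotalOrder ℓc ℓ₁ ℓ₂) (θ : V → Geometry.Rectangle O) →
    Geometry.IsRectRep O θ → ¬ (Geometry._⊆_∪_ O (θ c) (θ a) (θ b))
lemma1 O θ rep c⊆a∪b =
  [ ¬edge⇒¬meets O θ rep (λ ()) (λ ()) , ¬edge⇒¬meets O θ rep (λ ()) (λ ()) ]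
    (meets-⊆-∪ O {θ c} {θ a} {θ b} {θ z} c⊆a∪b (edge⇒meets O θ rep (λ ()) zc))
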